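{- Let $c$ be a positive integer, let $G$ be a graph, $k$ a positive integer, and let $\{u,v\}\in E(G)$ be an edge that is not critical in $G$ and satisfies $|N(u)\cap N(v)|<c$. Let $G'$ be obtained from $G$ by deleting the edge $\{u,v\}$. Then $(G,k)$ is a yes-instance of \textsc{$c$-Closed Vertex Deletion} if and only if $(G',k)$ is a yes-instance of \textsc{$c$-Closed Vertex Deletion}.
   Context: A graph is $c$-closed if every pair of distinct nonadjacent vertices has at most $c-1$ common neighbors. \textsc{$c$-Closed Vertex Deletion}: given a graph $G=(V,E)$ and a positive integer $k$, decide whether there is $S\subseteq V$ with $|S|\le k$ such that $G-S$ is $c$-closed. A bad pair is a pair of distinct nonadjacent vertices with at least $c$ common neighbors. A minimal forbidden subgraph (FSG) is a subgraph of $G$ on $c+2$ vertices consisting of two nonadjacent vertices $a,b$ (the bad pair) and $c$ common neighbors of $a$ and $b$ (the connecting vertices), together with all edges of $G$ among them; its critical edges are the $2c$ edges between $\{a,b\}$ and the connecting vertices. An edge of $G$ is critical in $G$ if it is a critical edge of some FSG in $G$. $N(w)$ is the set of neighbors of $w$. -}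

module Defs where

open import Data.Nat using (ℕ; _≤_; _<_)
open import Data.Bool using (Bool; true; false; _∧_; _∨_; not)
open import Data.Bool.Properties using (∧-comm; ∨-comm)
open import Data.Fin using (Fin; _≟_)
open import Data.Fin.Subset using (Subset; _∈_; _∉_; _⊆_; _∩_; ∁; ∣_∣; ⊤)
open import Data.Vec using (tabulate)
open import Data.Product using (Σ; _×_; _,_; ∃; ∃-syntax)
open import Data.Sum using (_⊎_)
open import Relation.Nullary using (¬_)
open import Relation.Nullary.Decidable using (⌊_⌋)
open import Relation.Binary.PropositionalEquality using (_≡_; refl; cong₂; trans; sym)

record Graph (n : ℕ) : Set where
  field
    adj     : Fin n → Fin n → Bool
    adj-sym : ∀ x y → adj x y ≡ adj y x
    adj-irr : ∀ x → adj x x ≡ false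
open Graph public

module _ {n : ℕ} (G : Graph n) where

  Adj : Fin n → Fin n → Set
  Adj x y = adj G x y ≡ true

  N : Fin n → Subset n
  N w = tabulate (adj G w)

  CClosedOn : ℕ → Subset n → Set
  CClosedOn c W = ∀ a b → a ∈ W → b ∈ W → ¬ (a ≡ b) → ¬ Adj a b →
                  ∣ N a ∩ N b ∩ W ∣ < c

  CClosed : ℕ → Set
  CClosed c = CClosedOn c ⊤

  YesInstance : ℕ → ℕ → Set
  YesInstance c k = ∃[ S ] (∣ S ∣ ≤ k × CClosedOn c (∁ S))

  -- A minimal forbidden subgraph: bad pair a , b (distinct, nonadjacent)
  -- together with a set C of exactly c common neighbours (connecting vertices).
  IsFSG : ℕ → Fin n → Fin n → Subset n → Set
  IsFSG c a b C = ¬ (a ≡ b) × ¬ Adj a b × ∣ C ∣ ≡ c × C ⊆ (N a ∩ N b)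

  CriticalEdgeOf : Fin n → Fin n → Subset n → Fin n → Fin n → Set
  CriticalEdgeOf a b C x y =
    ((x ≡ a ⊎ x ≡ b) × y ∈ C) ⊎ ((y ≡ a ⊎ y ≡ b) × x ∈ C)

  Critical : ℕ → Fin n → Fin n → Set
  Critical c x y = ∃[ a ] ∃[ b ] ∃[ C ] (IsFSG c a b C × CriticalEdgeOf a b C x y)

private
  isUV : ∀ {n} → Fin n → Fin n → Fin n → Fin n → Bool
  isUV u v x y = (⌊ x ≟ u ⌋ ∧ ⌊ y ≟ v ⌋) ∨ (⌊ x ≟ v ⌋ ∧ ⌊ y ≟ u ⌋)

  isUV-sym : ∀ {n} (u v x y : Fin n) → isUV u v x y ≡ isUV u v y x
  isUV-sym u v x y =
    trans (cong₂ _∨_ (∧-comm ⌊ x ≟ u ⌋ ⌊ y ≟ v ⌋) (∧-comm ⌊ x ≟ v ⌋ ⌊ y ≟ u ⌋))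
          (∨-comm (⌊ y ≟ v ⌋ ∧ ⌊ x ≟ u ⌋) (⌊ y ≟ u ⌋ ∧ ⌊ x ≟ v ⌋))

deleteEdge : ∀ {n} → Graph n → Fin n → Fin n → Graph n
deleteEdge G u v = record
  { adj     = λ x y → adj G x y ∧ not (isUV u v x y)
  ; adj-sym = λ x y → cong₂ (λ p q → p ∧ not q) (adj-sym G x y) (isUV-sym u v x y)
  ; adj-irr = λ x → cong₂ _∧_ (adj-irr G x) refl
  }

-- Both directions keep the deletion set S. Deleting {u,v} can only create a
-- new bad pair out of u and v themselves, and they have fewer than c common
-- neighbours. Conversely, every edge from a bad pair of G to one of its
-- common neighbours is critical (complete that neighbour to c connecting
-- vertices), so none of these edges is {u,v}; a bad pair of G - S therefore
-- stays bad in G' - S.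
module Submission where

open import Defs
open import Data.Bool using (true) renaming (_≟_ to _≟ᵇ_)
open import Data.Bool.Properties using (∧-conicalˡ)
open import Data.Empty using (⊥-elim)
open import Data.Fin using (Fin; zero; suc; _≟_)
open import Data.Fin.Subset using (Subset; _∈_; _⊆_; _∩_; ∣_∣; ⊥; inside; outside)
open import Data.Fin.Subset.Properties
  using (x∈p∩q⁺; x∈p∩q⁻; p⊆q⇒∣p∣≤∣q∣; ⊥⊆; ∣⊥∣≡0; ∩-comm)
open import Data.Nat using (ℕ; zero; suc; _≤_; _<_; _>_; s≤s; _≤?_)
open import Data.Nat.Properties using (≤-antisym; ≤-<-trans; ≰⇒>; <⇒≱)
open import Data.Product using (Σ; _×_; _,_; proj₁)
open import Data.Sum using (_⊎_; inj₁; inj₂)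
open import Data.Vec using (_∷_; []; here; there)
open import Data.Vec.Properties using (lookup∘tabulate; []=⇒lookup; lookup⇒[]=)
open import Function.Base using (_∘_)
open import Function.Bundles using (_⇔_; mk⇔)
open import Relation.Nullary using (¬_; yes; no)
open import Relation.Binary.PropositionalEquality using (_≡_; refl; sym; trans; cong; subst)

subset-of-size : ∀ {n} (X : Subset n) m → m ≤ ∣ X ∣ →
                 Σ (Subset n) λ C → C ⊆ X × ∣ C ∣ ≡ m
subset-of-size [] zero _ = [] , (λ ()) , refl
subset-of-size (outside ∷ X) m m≤ with subset-of-size X m m≤
... | C , C⊆X , ∣C∣ = outside ∷ C , (λ { (there p) → there (C⊆X p) }) , ∣C∣
subset-of-size {suc n} (inside ∷ X) zero _ = ⊥ , ⊥⊆ , ∣⊥∣≡0 (suc n)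
subset-of-size (inside ∷ X) (suc m) (s≤s m≤) with subset-of-size X m m≤
... | C , C⊆X , ∣C∣ =
  inside ∷ C , (λ { here → here ; (there p) → there (C⊆X p) }) , cong suc ∣C∣

subset-of-size-∋ : ∀ {n} (X : Subset n) {x} m → x ∈ X → m > 0 → m ≤ ∣ X ∣ →
                   Σ (Subset n) λ C → C ⊆ X × x ∈ C × ∣ C ∣ ≡ m
subset-of-size-∋ (inside ∷ X) {zero} (suc m) here _ (s≤s m≤) with subset-of-size X m m≤
... | C , C⊆X , ∣C∣ =
  inside ∷ C , (λ { here → here ; (there p) → there (C⊆X p) }) , here , cong suc ∣C∣
subset-of-size-∋ (outside ∷ X) {suc x} m (there x∈X) m>0 m≤
  with subset-of-size-∋ X m x∈X m>0 m≤
... | C , C⊆X , x∈C , ∣C∣ = outside ∷ C , (λ { (there p) → there (C⊆X p) }) , there x∈C , ∣C∣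
subset-of-size-∋ (inside ∷ X) {suc x} m (there x∈X) m>0 m≤ with m ≤? ∣ X ∣
... | yes m≤∣X∣ with subset-of-size-∋ X m x∈X m>0 m≤∣X∣
...   | C , C⊆X , x∈C , ∣C∣ = outside ∷ C , (λ { (there p) → there (C⊆X p) }) , there x∈C , ∣C∣
subset-of-size-∋ (inside ∷ X) {suc x} m (there x∈X) m>0 m≤ | no m≰∣X∣ =
  inside ∷ X , (λ p → p) , there x∈X , ≤-antisym (≰⇒> m≰∣X∣) m≤

∩-restrict-⊆ : ∀ {n} {p q r : Subset n} → p ∩ q ∩ r ⊆ p ∩ q
∩-restrict-⊆ {p = p} {q} x∈ = let (x∈p , x∈q∩r) = x∈p∩q⁻ p _ x∈ in
                               x∈p∩q⁺ (x∈p , proj₁ (x∈p∩q⁻ q _ x∈q∩r))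

module _ {n : ℕ} (G : Graph n) where

  Adj⇒∈N : ∀ {w x} → Adj G w x → x ∈ N G w
  Adj⇒∈N {w} {x} wx = lookup⇒[]= x _ (trans (lookup∘tabulate (adj G w) x) wx)

  ∈N⇒Adj : ∀ {w x} → x ∈ N G w → Adj G w x
  ∈N⇒Adj {w} {x} x∈N = trans (sym (lookup∘tabulate (adj G w) x)) ([]=⇒lookup x∈N)

  ∈-common⁺ : ∀ {a b x} {W : Subset n} → Adj G a x → Adj G b x → x ∈ W →
              x ∈ N G a ∩ N G b ∩ W
  ∈-common⁺ ax bx x∈W = x∈p∩q⁺ (Adj⇒∈N ax , x∈p∩q⁺ (Adj⇒∈N bx , x∈W))

  ∈-common⁻ : ∀ {a b x} {W : Subset n} → x ∈ N G a ∩ N G b ∩ W →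
              Adj G a x × Adj G b x × x ∈ W
  ∈-common⁻ {a} {b} {W = W} p with x∈p∩q⁻ (N G a) _ p
  ... | x∈Na , q with x∈p∩q⁻ (N G b) W q
  ... | x∈Nb , x∈W = ∈N⇒Adj x∈Na , ∈N⇒Adj x∈Nb , x∈W

  common-neighbours-critical :
    ∀ {c a b x} {W : Subset n} → c > 0 → ¬ a ≡ b → ¬ Adj G a b →
    c ≤ ∣ N G a ∩ N G b ∩ W ∣ → x ∈ N G a ∩ N G b ∩ W →
    Critical G c a x × Critical G c b x
  common-neighbours-critical {c} {a} {b} c>0 a≢b ¬ab c≤ x∈
    with subset-of-size-∋ _ c x∈ c>0 c≤
  ... | C , C⊆ , x∈C , ∣C∣ =
    (a , b , C , fsg , inj₁ (inj₁ refl , x∈C)) , (a , b , C , fsg , inj₁ (inj₂ refl , x∈C))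
    where
    fsg : IsFSG G c a b C
    fsg = a≢b , ¬ab , ∣C∣ , ∩-restrict-⊆ ∘ C⊆

  Critical-sym : ∀ {c x y} → Critical G c x y → Critical G c y x
  Critical-sym (a , b , C , fsg , inj₁ e) = a , b , C , fsg , inj₂ e
  Critical-sym (a , b , C , fsg , inj₂ e) = a , b , C , fsg , inj₁ e

SameEdge : ∀ {n} → Fin n → Fin n → Fin n → Fin n → Set
SameEdge u v x y = (x ≡ u × y ≡ v) ⊎ (x ≡ v × y ≡ u)

module _ {n : ℕ} (G : Graph n) (u v : Fin n) where

  private
    G' = deleteEdge G u v

  deleteEdge-⊆ : ∀ {x y} → Adj G' x y → Adj G x y
  deleteEdge-⊆ {x} {y} = ∧-conicalˡ (adj G x y) _

  deleteEdge-common-⊆ : ∀ {a b} {W : Subset n} → N G' a ∩ N G' b ∩ W ⊆ N G a ∩ N G b ∩ W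
  deleteEdge-common-⊆ p =
    let (ax , bx , x∈W) = ∈-common⁻ G' p in ∈-common⁺ G (deleteEdge-⊆ ax) (deleteEdge-⊆ bx) x∈W

  deleteEdge-adj : ∀ {x y} → Adj G x y → Adj G' x y ⊎ SameEdge u v x y
  deleteEdge-adj {x} {y} xy rewrite xy with x ≟ u | y ≟ v | x ≟ v | y ≟ u
  ... | yes p | yes q | _     | _     = inj₂ (inj₁ (p , q))
  ... | _     | _     | yes r | yes s = inj₂ (inj₂ (r , s))
  ... | no _  | _     | no _  | _     = inj₁ refl
  ... | no _  | _     | yes _ | no _  = inj₁ refl
  ... | yes _ | no _  | no _  | _     = inj₁ refl
  ... | yes _ | no _  | yes _ | no _  = inj₁ refl

  critical-edge-kept : ∀ {c x y} → ¬ Critical G c u v →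
                       Adj G x y → Critical G c x y → Adj G' x y
  critical-edge-kept ¬crit xy crit with deleteEdge-adj xy
  ... | inj₁ xy'                  = xy'
  ... | inj₂ (inj₁ (refl , refl)) = ⊥-elim (¬crit crit)
  ... | inj₂ (inj₂ (refl , refl)) = ⊥-elim (¬crit (Critical-sym G crit))

  common-neighbours-of-edge<c : ∀ {c a b} → ∣ N G u ∩ N G v ∣ < c →
                                SameEdge u v a b → ∣ N G a ∩ N G b ∣ < c
  common-neighbours-of-edge<c uv<c (inj₁ (refl , refl)) = uv<c
  common-neighbours-of-edge<c uv<c (inj₂ (refl , refl)) =
    subst (λ X → ∣ X ∣ < _) (∩-comm (N G u) (N G v)) uv<c

  deleteEdge-preserves-closed : ∀ {c W} → ∣ N G u ∩ N G v ∣ < c →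
                                CClosedOn G c W → CClosedOn G' c W
  deleteEdge-preserves-closed uv<c closed a b a∈W b∈W a≢b ¬ab'
    with adj G a b ≟ᵇ true
  ... | no ¬ab = ≤-<-trans (p⊆q⇒∣p∣≤∣q∣ deleteEdge-common-⊆)
                           (closed a b a∈W b∈W a≢b ¬ab)
  ... | yes ab with deleteEdge-adj ab
  ...   | inj₁ ab' = ⊥-elim (¬ab' ab')
  ...   | inj₂ same =
    ≤-<-trans (p⊆q⇒∣p∣≤∣q∣ (∩-restrict-⊆ ∘ deleteEdge-common-⊆))
              (common-neighbours-of-edge<c uv<c same)

  deleteEdge-reflects-closed : ∀ {c W} → c > 0 → ¬ Critical G c u v →
                               CClosedOn G' c W → CClosedOn G c W
  deleteEdge-reflects-closed {c} {W} c>0 ¬crit closed' a b a∈W b∈W a≢b ¬ab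
    with c ≤? ∣ N G a ∩ N G b ∩ W ∣
  ... | no c≰ = ≰⇒> c≰
  ... | yes c≤ = ⊥-elim (<⇒≱ (≤-<-trans (p⊆q⇒∣p∣≤∣q∣ kept) bound') c≤)
    where
    bound' : ∣ N G' a ∩ N G' b ∩ W ∣ < c
    bound' = closed' a b a∈W b∈W a≢b (λ ab' → ¬ab (deleteEdge-⊆ ab'))
    kept : N G a ∩ N G b ∩ W ⊆ N G' a ∩ N G' b ∩ W
    kept p with ∈-common⁻ G p | common-neighbours-critical G c>0 a≢b ¬ab c≤ p
    ... | ax , bx , x∈W | crit-ax , crit-bx =
      ∈-common⁺ G' (critical-edge-kept ¬crit ax crit-ax)
                   (critical-edge-kept ¬crit bx crit-bx) x∈W

lemma1 : (c : ℕ) → c > 0 → {n : ℕ} (G : Graph n) (k : ℕ) → k > 0 →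
    (u v : Fin n) → Adj G u v → ¬ Critical G c u v →
    ∣ N G u ∩ N G v ∣ < c →
    YesInstance G c k ⇔ YesInstance (deleteEdge G u v) c k
lemma1 c c>0 G k _ u v _ ¬crit uv<c = mk⇔
  (λ (S , ∣S∣≤k , closed) → S , ∣S∣≤k , deleteEdge-preserves-closed G u v uv<c closed)
  (λ (S , ∣S∣≤k , closed) → S , ∣S∣≤k , deleteEdge-reflects-closed G u v c>0 ¬crit closed)
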